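{- Let $n$ be a positive integer, let $\mathcal L\subseteq[n]$, and let $m$ be the largest integer such that $[m]\subseteq\mathcal L$ (with $[0]=\emptyset$). If $m>\frac12(n-1)$, then the double path $\overrightarrow{P}_{n,\mathcal L}$ requires the nSSP.
   Context: A digraph $G$ has vertex set $V(G)=[n]$ and arc set $E(G)\subseteq [n]\times[n]$; arcs $(v,v)$ are loops. $\mathcal M(G)$ is the set of real $n\times n$ matrices $A=(a_{ij})$ with $a_{ij}\neq 0$ if and only if $(i,j)\in E(G)$. A real $n\times n$ matrix $A$ has the nSSP if the only real matrix $X$ with $A\circ X=O$ (entrywise product) and $AX^\top-X^\top A=O$ is $X=O$. $G$ requires the nSSP if every $A\in\mathcal M(G)$ has the nSSP. The double path $\overrightarrow{P}_{n,\mathcal L}$ has vertex set $[n]$ and arc set $\{(i,i+1),(i+1,i): i\in[n-1]\}\cup\{(\ell,\ell):\ell\in\mathcal L\}$. -}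

module Defs where

open import Level using (0ℓ)
open import Data.Nat as ℕ using (ℕ; zero; suc)
open import Data.Fin using (Fin; toℕ)
import Data.Fin as Fin
open import Data.Fin.Subset using (Subset; _∈_)
open import Data.Product using (Σ; ∃; _×_; _,_)
open import Data.Sum using (_⊎_)
open import Relation.Nullary using (¬_)
open import Relation.Binary.PropositionalEquality using (_≡_; _≢_)
open import Relation.Binary.Definitions using (Trichotomous)

-- The real numbers, axiomatised as a complete ordered field
-- (every model is isomorphic to ℝ).  Equality is propositional.

record Reals : Set₁ where
  infixl 6 _+_
  infixl 7 _*_
  infix  4 _<_ _≤_
  field
    ℝ    : Set
    0r 1r : ℝ
    _+_ _*_ : ℝ → ℝ → ℝ
    -_   : ℝ → ℝ
    _⁻¹  : (x : ℝ) → x ≢ 0r → ℝ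
    _<_  : ℝ → ℝ → Set
    +-assoc : ∀ x y z → (x + y) + z ≡ x + (y + z)
    +-comm  : ∀ x y → x + y ≡ y + x
    +-identityˡ : ∀ x → 0r + x ≡ x
    +-inverseˡ  : ∀ x → (- x) + x ≡ 0r
    *-assoc : ∀ x y z → (x * y) * z ≡ x * (y * z)
    *-comm  : ∀ x y → x * y ≡ y * x
    *-identityˡ : ∀ x → 1r * x ≡ x
    *-inverseˡ  : ∀ x (p : x ≢ 0r) → (x ⁻¹) p * x ≡ 1r
    distribˡ : ∀ x y z → x * (y + z) ≡ x * y + x * z
    0≢1 : 0r ≢ 1r
    <-trans : ∀ {x y z} → x < y → y < z → x < z
    <-tri   : Trichotomous _≡_ _<_
    +-mono-< : ∀ {x y} z → x < y → x + z < y + z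
    *-pos    : ∀ {x y} → 0r < x → 0r < y → 0r < x * y
    sup : (S : ℝ → Set) → (∃ λ x → S x) →
          (∃ λ b → ∀ x → S x → x < b ⊎ x ≡ b) →
          ∃ λ s → (∀ x → S x → x < s ⊎ x ≡ s) ×
                  (∀ b → (∀ x → S x → x < b ⊎ x ≡ b) → s < b ⊎ s ≡ b)

  _≤_ : ℝ → ℝ → Set
  x ≤ y = x < y ⊎ x ≡ y

-- Digraphs on [n] (vertex i+1 of the paper is  i : Fin n) and matrices.

Digraph : ℕ → Set₁
Digraph n = Fin n → Fin n → Set

module _ (R : Reals) where
  open Reals R

  Matrix : ℕ → Set
  Matrix n = Fin n → Fin n → ℝ

  ∑ : ∀ {n} → (Fin n → ℝ) → ℝ
  ∑ {zero}  f = 0r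
  ∑ {suc n} f = f Fin.zero + ∑ (λ i → f (Fin.suc i))

  InPattern : ∀ {n} → Digraph n → Matrix n → Set
  InPattern G A = ∀ i j → (A i j ≢ 0r → G i j) × (G i j → A i j ≢ 0r)

  -- A has the nSSP: A ∘ X = O and A Xᵀ − Xᵀ A = O imply X = O
  nSSP : ∀ {n} → Matrix n → Set
  nSSP {n} A = ∀ (X : Matrix n) →
    (∀ i j → A i j * X i j ≡ 0r) →
    (∀ i j → ∑ (λ k → A i k * X j k) ≡ ∑ (λ k → X k i * A k j)) →
    ∀ i j → X i j ≡ 0r

  RequiresNSSP : ∀ {n} → Digraph n → Set
  RequiresNSSP {n} G = ∀ (A : Matrix n) → InPattern G A → nSSP A

DoublePath : (n : ℕ) → Subset n → Digraph n
DoublePath n L i j =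
  (toℕ j ≡ suc (toℕ i)) ⊎ (toℕ i ≡ suc (toℕ j)) ⊎ (i ≡ j × i ∈ L)

-- [m] ⊆ L  (vertices 1..m, i.e. indices with toℕ i < m)
PrefixIn : ∀ {n} → ℕ → Subset n → Set
PrefixIn m L = ∀ i → toℕ i ℕ.< m → i ∈ L

IsLargestPrefix : (n : ℕ) → Subset n → ℕ → Set
IsLargestPrefix n L m =
  m ℕ.≤ n × PrefixIn m L × (∀ k → k ℕ.≤ n → PrefixIn k L → k ℕ.≤ m)

module Submission where

-- Extend A and Z = Xᵀ by zeros to ℕ × ℕ, so that AZ = ZA holds at every index, A is
-- tridiagonal with nonzero sub- and superdiagonal inside [0,n)², and Z vanishes outside
-- [0,n)².  If Z vanishes on every antidiagonal i'+j' < i+j+1, the (i,j) entry of AZ = ZA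
-- reduces to
--   A(i,i+1) Z(i+1,j) = Z(i,j+1) A(j+1,j),
-- so one zero on the antidiagonal i+j+1 forces all of them.  A ∘ X = O makes Z vanish on the
-- superdiagonal and, through the loops at the first m vertices, at the first m diagonal
-- entries; hence every antidiagonal s < n ≤ 2m has a zero at its middle, and every
-- antidiagonal s ≥ n has one at (s,0).  Induction on s gives Z = O.

open import Defs
open import Data.Nat using (ℕ; zero; suc; _+_; _*_; _∸_; _≤_; _<_; _≤?_; _<?_; z≤n; s≤s; NonZero)
import Data.Nat.Properties as ℕ
open import Data.Fin using (Fin; toℕ; fromℕ<)
import Data.Fin as Fin
open import Data.Fin.Properties using (toℕ<n; toℕ-fromℕ<; toℕ-injective)
open import Data.Fin.Subset using (Subset)
open import Data.Product using (∃; _,_; proj₁; proj₂)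
open import Data.Sum using (_⊎_; inj₁; inj₂; swap)
open import Function using (_∘_)
open import Relation.Nullary using (¬_; Dec; yes; no; contradiction)
open import Relation.Binary.PropositionalEquality
open import Relation.Binary.Definitions using (tri<; tri≈; tri>)

fin-or-≥ : ∀ n i → (∃ λ (a : Fin n) → toℕ a ≡ i) ⊎ n ≤ i
fin-or-≥ n i with i <? n
... | yes i<n = inj₁ (fromℕ< i<n , toℕ-fromℕ< i<n)
... | no i≮n = inj₂ (ℕ.≮⇒≥ i≮n)

<⇒¬≤⊎≤ : ∀ {i j n} → i < n → j < n → ¬ (n ≤ i ⊎ n ≤ j)
<⇒¬≤⊎≤ i<n _ (inj₁ n≤i) = ℕ.<⇒≱ i<n n≤i
<⇒¬≤⊎≤ _ j<n (inj₂ n≤j) = ℕ.<⇒≱ j<n n≤j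

≤⊎suc< : ∀ {k i} → k ≢ suc i → k ≤ i ⊎ suc i < k
≤⊎suc< {k} {i} k≢1+i with k ≤? i
... | yes k≤i = inj₁ k≤i
... | no k≰i = inj₂ (ℕ.≤∧≢⇒< (ℕ.≰⇒> k≰i) (k≢1+i ∘ sym))

halve : ∀ s → ∃ λ t → t + t ≡ s ⊎ t + suc t ≡ s
halve zero = 0 , inj₁ refl
halve (suc s) with halve s
... | t , inj₁ t+t≡s = t , inj₂ (trans (ℕ.+-suc t t) (cong suc t+t≡s))
... | t , inj₂ t+1+t≡s = suc t , inj₁ (cong suc t+1+t≡s)

m+m<2n⇒m<n : ∀ {m n} → m + m < 2 * n → m < n
m+m<2n⇒m<n {m} {n} =
  ℕ.*-cancelˡ-< 2 m n ∘ subst (_< 2 * n) (cong (m +_) (sym (ℕ.+-identityʳ m)))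

DoublePath-sym : ∀ {n L} {a b : Fin n} → DoublePath n L a b → DoublePath n L b a
DoublePath-sym (inj₁ e) = inj₂ (inj₁ e)
DoublePath-sym (inj₂ (inj₁ e)) = inj₁ e
DoublePath-sym (inj₂ (inj₂ (refl , a∈L))) = inj₂ (inj₂ (refl , a∈L))

DoublePath⇒≤suc : ∀ {n L} {a b : Fin n} → DoublePath n L a b → toℕ b ≤ suc (toℕ a)
DoublePath⇒≤suc (inj₁ e) = ℕ.≤-reflexive e
DoublePath⇒≤suc {b = b} (inj₂ (inj₁ e)) =
  ℕ.m≤n⇒m≤1+n (subst (toℕ b ≤_) (sym e) (ℕ.n≤1+n (toℕ b)))
DoublePath⇒≤suc (inj₂ (inj₂ (refl , _))) = ℕ.n≤1+n _

module _ (R : Reals) where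
  open Reals R hiding (_<_; _≤_) renaming (_+_ to _+ℝ_; _*_ to _·_)
  open ≡-Reasoning

  x+x≡x⇒x≡0 : ∀ x → x +ℝ x ≡ x → x ≡ 0r
  x+x≡x⇒x≡0 x x+x≡x = begin
    x                 ≡⟨ sym (+-identityˡ x) ⟩
    0r +ℝ x           ≡⟨ cong (_+ℝ x) (sym (+-inverseˡ x)) ⟩
    (- x +ℝ x) +ℝ x   ≡⟨ +-assoc (- x) x x ⟩
    - x +ℝ (x +ℝ x)   ≡⟨ cong (- x +ℝ_) x+x≡x ⟩
    - x +ℝ x          ≡⟨ +-inverseˡ x ⟩
    0r                ∎

  *-zeroʳ : ∀ x → x · 0r ≡ 0r
  *-zeroʳ x = x+x≡x⇒x≡0 (x · 0r) (trans (sym (distribˡ x 0r 0r)) (cong (x ·_) (+-identityˡ 0r)))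

  *-zeroˡ : ∀ x → 0r · x ≡ 0r
  *-zeroˡ x = trans (*-comm 0r x) (*-zeroʳ x)

  x≡0⇒x·y≡0 : ∀ {x y} → x ≡ 0r → x · y ≡ 0r
  x≡0⇒x·y≡0 {y = y} refl = *-zeroˡ y

  y≡0⇒x·y≡0 : ∀ {x y} → y ≡ 0r → x · y ≡ 0r
  y≡0⇒x·y≡0 {x} refl = *-zeroʳ x

  x·y≡0∧x≢0⇒y≡0 : ∀ {x y} → x · y ≡ 0r → x ≢ 0r → y ≡ 0r
  x·y≡0∧x≢0⇒y≡0 {x} {y} x·y≡0 x≢0 = begin
    y                   ≡⟨ sym (*-identityˡ y) ⟩
    1r · y              ≡⟨ cong (_· y) (sym (*-inverseˡ x x≢0)) ⟩
    ((x ⁻¹) x≢0 · x) · y ≡⟨ *-assoc _ x y ⟩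
    (x ⁻¹) x≢0 · (x · y) ≡⟨ y≡0⇒x·y≡0 x·y≡0 ⟩
    0r                  ∎

  x·y≡0∧y≢0⇒x≡0 : ∀ {x y} → x · y ≡ 0r → y ≢ 0r → x ≡ 0r
  x·y≡0∧y≢0⇒x≡0 {x} {y} x·y≡0 = x·y≡0∧x≢0⇒y≡0 (trans (*-comm y x) x·y≡0)

  _≟0 : (x : ℝ) → Dec (x ≡ 0r)
  x ≟0 with <-tri x 0r
  ... | tri< _ x≢0 _ = no x≢0
  ... | tri≈ _ x≡0 _ = yes x≡0
  ... | tri> _ x≢0 _ = no x≢0

  pad : ∀ {n} → (Fin n → ℝ) → ℕ → ℝ
  pad {zero}  f i       = 0r
  pad {suc n} f zero    = f Fin.zero
  pad {suc n} f (suc i) = pad (f ∘ Fin.suc) i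

  pad-toℕ : ∀ {n} (f : Fin n → ℝ) a → pad f (toℕ a) ≡ f a
  pad-toℕ f Fin.zero    = refl
  pad-toℕ f (Fin.suc a) = pad-toℕ (f ∘ Fin.suc) a

  pad-cong : ∀ {n} {f g : Fin n → ℝ} → f ≗ g → pad f ≗ pad g
  pad-cong {zero}  f≗g i       = refl
  pad-cong {suc n} f≗g zero    = f≗g Fin.zero
  pad-cong {suc n} f≗g (suc i) = pad-cong (f≗g ∘ Fin.suc) i

  pad-· : ∀ {n} (f g : Fin n → ℝ) → pad (λ a → f a · g a) ≗ λ i → pad f i · pad g i
  pad-· {zero}  f g i       = sym (*-zeroˡ 0r)
  pad-· {suc n} f g zero    = refl
  pad-· {suc n} f g (suc i) = pad-· (f ∘ Fin.suc) (g ∘ Fin.suc) i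

  pad-elim : ∀ {n} (P : ℝ → Set) (f : Fin n → ℝ) i →
             (n ≤ i → P 0r) → (∀ a → toℕ a ≡ i → P (f a)) → P (pad f i)
  pad-elim {zero}  P f i       outside inside = outside z≤n
  pad-elim {suc n} P f zero    outside inside = inside Fin.zero refl
  pad-elim {suc n} P f (suc i) outside inside =
    pad-elim P (f ∘ Fin.suc) i (outside ∘ s≤s) (λ a e → inside (Fin.suc a) (cong suc e))

  ∑-zero : ∀ {n} (f : Fin n → ℝ) → (∀ a → f a ≡ 0r) → ∑ R f ≡ 0r
  ∑-zero {zero}  f f≡0 = refl
  ∑-zero {suc n} f f≡0 =
    trans (cong₂ _+ℝ_ (f≡0 Fin.zero) (∑-zero (f ∘ Fin.suc) (f≡0 ∘ Fin.suc))) (+-identityˡ 0r)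

  ∑-supported : ∀ {n} (f : Fin n → ℝ) p → (∀ a → toℕ a ≢ p → f a ≡ 0r) → ∑ R f ≡ pad f p
  ∑-supported {zero}  f p       f≡0 = refl
  ∑-supported {suc n} f zero    f≡0 = begin
    f Fin.zero +ℝ ∑ R (f ∘ Fin.suc)
      ≡⟨ cong (f Fin.zero +ℝ_) (∑-zero (f ∘ Fin.suc) (λ a → f≡0 (Fin.suc a) λ ())) ⟩
    f Fin.zero +ℝ 0r                ≡⟨ +-comm (f Fin.zero) 0r ⟩
    0r +ℝ f Fin.zero                ≡⟨ +-identityˡ (f Fin.zero) ⟩
    f Fin.zero                      ∎
  ∑-supported {suc n} f (suc p) f≡0 = begin
    f Fin.zero +ℝ ∑ R (f ∘ Fin.suc) ≡⟨ cong (_+ℝ ∑ R (f ∘ Fin.suc)) (f≡0 Fin.zero λ ()) ⟩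
    0r +ℝ ∑ R (f ∘ Fin.suc)         ≡⟨ +-identityˡ _ ⟩
    ∑ R (f ∘ Fin.suc)
      ≡⟨ ∑-supported (f ∘ Fin.suc) p (λ a a≢p → f≡0 (Fin.suc a) (a≢p ∘ ℕ.suc-injective)) ⟩
    pad (f ∘ Fin.suc) p             ∎

  ∑-·-supported : ∀ {n} (f g : Fin n → ℝ) {F G : ℕ → ℝ} p → pad f ≗ F → pad g ≗ G →
                  (∀ k → k ≢ p → F k · G k ≡ 0r) → ∑ R (λ a → f a · g a) ≡ F p · G p
  ∑-·-supported {n} f g {F} {G} p f≗F g≗G FG≡0 = begin
    ∑ R fg    ≡⟨ ∑-supported fg p fg≡0 ⟩
    pad fg p  ≡⟨ pad-fg p ⟩
    F p · G p ∎
    where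
    fg : Fin n → ℝ
    fg a = f a · g a
    pad-fg : ∀ k → pad fg k ≡ F k · G k
    pad-fg k = trans (pad-· f g k) (cong₂ _·_ (f≗F k) (g≗G k))
    fg≡0 : ∀ a → toℕ a ≢ p → fg a ≡ 0r
    fg≡0 a a≢p = trans (sym (pad-toℕ fg a)) (trans (pad-fg (toℕ a)) (FG≡0 (toℕ a) a≢p))

  padM : ∀ {n} → Matrix R n → ℕ → ℕ → ℝ
  padM M i j = pad (λ a → pad (M a) j) i

  padM-toℕ : ∀ {n} (M : Matrix R n) a b → padM M (toℕ a) (toℕ b) ≡ M a b
  padM-toℕ M a b = trans (pad-toℕ _ a) (pad-toℕ (M a) b)

  pad-row : ∀ {n} (M : Matrix R n) a → pad (M a) ≗ padM M (toℕ a)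
  pad-row M a j = sym (pad-toℕ (λ a' → pad (M a') j) a)

  pad-col : ∀ {n} (M : Matrix R n) b → pad (λ a → M a b) ≗ λ i → padM M i (toℕ b)
  pad-col M b = pad-cong (λ a → sym (pad-toℕ (M a) b))

  padM-elim : ∀ {n} (M : Matrix R n) (P : ℕ → ℕ → ℝ → Set) →
              (∀ {i j} → n ≤ i ⊎ n ≤ j → P i j 0r) → (∀ a b → P (toℕ a) (toℕ b) (M a b)) →
              ∀ i j → P i j (padM M i j)
  padM-elim M P outside inside i j =
    pad-elim (P i j) _ i (outside ∘ inj₁) λ a a≡i →
    pad-elim (P i j) (M a) j (outside ∘ inj₂) λ b b≡j →
    subst₂ (λ i j → P i j (M a b)) a≡i b≡j (inside a b)

  padM-outside : ∀ {n} (M : Matrix R n) {i j} → n ≤ i ⊎ n ≤ j → padM M i j ≡ 0r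
  padM-outside {n} M {i} {j} = padM-elim M (λ i j x → n ≤ i ⊎ n ≤ j → x ≡ 0r) (λ _ _ → refl)
    (λ a b outside → contradiction outside (<⇒¬≤⊎≤ (toℕ<n a) (toℕ<n b))) i j

  module BandedCommutation
    (n m : ℕ) (A Z : ℕ → ℕ → ℝ)
    (A-above : ∀ i k → suc i < k → A i k ≡ 0r)
    (A-below : ∀ i k → suc k < i → A i k ≡ 0r)
    (A-super≢0 : ∀ i → suc i < n → A i (suc i) ≢ 0r)
    (A-sub≢0 : ∀ i → suc i < n → A (suc i) i ≢ 0r)
    (Z-outside : ∀ {i j} → n ≤ i ⊎ n ≤ j → Z i j ≡ 0r)
    (Z-diagonal : ∀ t → t < m → Z t t ≡ 0r)
    (Z-super : ∀ t → Z t (suc t) ≡ 0r)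
    (n≤2m : n ≤ 2 * m)
    -- AZ = ZA in the only form needed: each side of the (i,j) entry has at most one nonzero term
    (AZ≡ZA : ∀ i j p q →
             (∀ k → k ≢ p → A i k · Z k j ≡ 0r) → (∀ k → k ≢ q → Z i k · A k j ≡ 0r) →
             A i p · Z p j ≡ Z i q · A q j)
    where

    ZeroBelow : ℕ → Set
    ZeroBelow s = ∀ i j → i + j < s → Z i j ≡ 0r

    AZ≡ZA-across : ∀ i j → ZeroBelow (suc (i + j)) →
                   A i (suc i) · Z (suc i) j ≡ Z i (suc j) · A (suc j) j
    AZ≡ZA-across i j below = AZ≡ZA i j (suc i) (suc j) left right
      where
      left : ∀ k → k ≢ suc i → A i k · Z k j ≡ 0r
      left k k≢1+i with ≤⊎suc< k≢1+i
      ... | inj₁ k≤i = y≡0⇒x·y≡0 (below k j (s≤s (ℕ.+-monoˡ-≤ j k≤i)))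
      ... | inj₂ 1+i<k = x≡0⇒x·y≡0 (A-above i k 1+i<k)
      right : ∀ k → k ≢ suc j → Z i k · A k j ≡ 0r
      right k k≢1+j with ≤⊎suc< k≢1+j
      ... | inj₁ k≤j = x≡0⇒x·y≡0 (below i k (s≤s (ℕ.+-monoʳ-≤ i k≤j)))
      ... | inj₂ 1+j<k = y≡0⇒x·y≡0 (A-below k j 1+j<k)

    shift-down : ∀ i j → ZeroBelow (suc (i + j)) → Z i (suc j) ≡ 0r → Z (suc i) j ≡ 0r
    shift-down i j below z with suc i <? n
    ... | yes 1+i<n =
      x·y≡0∧x≢0⇒y≡0 (trans (AZ≡ZA-across i j below) (x≡0⇒x·y≡0 z)) (A-super≢0 i 1+i<n)
    ... | no 1+i≮n = Z-outside (inj₁ (ℕ.≮⇒≥ 1+i≮n))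

    shift-up : ∀ i j → ZeroBelow (suc (i + j)) → Z (suc i) j ≡ 0r → Z i (suc j) ≡ 0r
    shift-up i j below z with suc j <? n
    ... | yes 1+j<n =
      x·y≡0∧y≢0⇒x≡0 (trans (sym (AZ≡ZA-across i j below)) (y≡0⇒x·y≡0 z)) (A-sub≢0 j 1+j<n)
    ... | no 1+j≮n = Z-outside (inj₂ (ℕ.≮⇒≥ 1+j≮n))

    walk-down : ∀ d i j → ZeroBelow (i + (d + j)) → Z i (d + j) ≡ 0r → Z (i + d) j ≡ 0r
    walk-down zero    i j below z = subst (λ x → Z x j ≡ 0r) (sym (ℕ.+-identityʳ i)) z
    walk-down (suc d) i j below z = subst (λ x → Z x j ≡ 0r) (sym (ℕ.+-suc i d))
      (walk-down d (suc i) j below′ (shift-down i (d + j) below′ z))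
      where
      below′ : ZeroBelow (suc (i + (d + j)))
      below′ = subst ZeroBelow (ℕ.+-suc i (d + j)) below

    walk-up : ∀ d i j → ZeroBelow ((d + i) + j) → Z (d + i) j ≡ 0r → Z i (d + j) ≡ 0r
    walk-up zero    i j below z = z
    walk-up (suc d) i j below z = subst (λ x → Z i x ≡ 0r) (ℕ.+-suc d j)
      (walk-up d i (suc j) below′ (shift-up (d + i) j below z))
      where
      below′ : ZeroBelow ((d + i) + suc j)
      below′ = subst ZeroBelow (sym (ℕ.+-suc (d + i) j)) below

    vanish-along : ∀ {s} → ZeroBelow s → ∀ {a b i j} → a + b ≡ s → i + j ≡ s → Z a b ≡ 0r → Z i j ≡ 0r
    vanish-along below {a} {b} {i} {j} refl i+j≡a+b z with ℕ.≤-total a i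
    ... | inj₁ a≤i with ℕ.m≤n⇒∃[o]m+o≡n a≤i
    ...   | d , refl = walk-down d a j (subst ZeroBelow (cong (a +_) b≡d+j) below)
                                       (subst (λ x → Z a x ≡ 0r) b≡d+j z)
      where
      b≡d+j : b ≡ d + j
      b≡d+j = ℕ.+-cancelˡ-≡ a b (d + j) (trans (sym i+j≡a+b) (ℕ.+-assoc a d j))
    vanish-along below {a} {b} {i} {j} refl i+j≡a+b z | inj₂ i≤a
      with a ∸ i | ℕ.m∸n+n≡m i≤a
    ...   | d | refl = subst (λ x → Z i x ≡ 0r) (sym j≡d+b) (walk-up d i b below z)
      where
      j≡d+b : j ≡ d + b
      j≡d+b = ℕ.+-cancelˡ-≡ i j (d + b)
                (trans i+j≡a+b (trans (cong (_+ b) (ℕ.+-comm d i)) (ℕ.+-assoc i d b)))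

    vanish-antidiagonal : ∀ s → ZeroBelow s → ∀ i j → i + j ≡ s → Z i j ≡ 0r
    vanish-antidiagonal s below i j i+j≡s with n ≤? s
    ... | yes n≤s = vanish-along below (ℕ.+-identityʳ s) i+j≡s (Z-outside (inj₁ n≤s))
    ... | no n≰s with halve s
    ...   | t , inj₁ t+t≡s = vanish-along below t+t≡s i+j≡s (Z-diagonal t (m+m<2n⇒m<n t+t<2m))
      where
      t+t<2m : t + t < 2 * m
      t+t<2m = ℕ.<-≤-trans (subst (_< n) (sym t+t≡s) (ℕ.≰⇒> n≰s)) n≤2m
    ...   | t , inj₂ t+1+t≡s = vanish-along below t+1+t≡s i+j≡s (Z-super t)

    below-all : ∀ s → ZeroBelow s
    below-all zero i j ()
    below-all (suc s) i j i+j<1+s with ℕ.m<1+n⇒m<n∨m≡n i+j<1+s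
    ... | inj₁ i+j<s = below-all s i j i+j<s
    ... | inj₂ i+j≡s = vanish-antidiagonal s (below-all s) i j i+j≡s

    Z≡0 : ∀ i j → Z i j ≡ 0r
    Z≡0 i j = below-all (suc (i + j)) i j ℕ.≤-refl

  module DoublePathPadding
    (n : ℕ) (L : Subset n) (m : ℕ) (prefix : PrefixIn m L) (A X : Matrix R n)
    (A∈𝓜 : InPattern R (DoublePath n L) A)
    (A∘X≡O : ∀ i j → A i j · X i j ≡ 0r)
    (AXᵀ≡XᵀA : ∀ i j → ∑ R (λ k → A i k · X j k) ≡ ∑ R (λ k → X k i · A k j))
    where

    A′ Z : ℕ → ℕ → ℝ
    A′ = padM A
    Z i j = padM X j i

    arc⇒A≢0 : ∀ {a b} → DoublePath n L a b → A a b ≢ 0r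
    arc⇒A≢0 {a} {b} = proj₂ (A∈𝓜 a b)

    ¬arc⇒A≡0 : ∀ {a b} → ¬ DoublePath n L a b → A a b ≡ 0r
    ¬arc⇒A≡0 {a} {b} ¬arc with A a b ≟0
    ... | yes A≡0 = A≡0
    ... | no A≢0 = contradiction (proj₁ (A∈𝓜 a b) A≢0) ¬arc

    arc⇒X≡0 : ∀ {a b} → DoublePath n L a b → X a b ≡ 0r
    arc⇒X≡0 {a} {b} arc = x·y≡0∧x≢0⇒y≡0 (A∘X≡O a b) (arc⇒A≢0 arc)

    A′-above : ∀ i k → suc i < k → A′ i k ≡ 0r
    A′-above = padM-elim A (λ i k x → suc i < k → x ≡ 0r) (λ _ _ → refl)
      (λ a b 1+a<b → ¬arc⇒A≡0 (ℕ.<⇒≱ 1+a<b ∘ DoublePath⇒≤suc))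

    A′-below : ∀ i k → suc k < i → A′ i k ≡ 0r
    A′-below = padM-elim A (λ i k x → suc k < i → x ≡ 0r) (λ _ _ → refl)
      (λ a b 1+b<a → ¬arc⇒A≡0 (ℕ.<⇒≱ 1+b<a ∘ DoublePath⇒≤suc ∘ DoublePath-sym))

    A′-super≢0 : ∀ i → suc i < n → A′ i (suc i) ≢ 0r
    A′-super≢0 i = padM-elim A (λ i k x → k ≡ suc i → k < n → x ≢ 0r)
      (λ outside k≡1+i k<n →
         contradiction outside (<⇒¬≤⊎≤ (ℕ.<⇒≤ (subst (_< n) k≡1+i k<n)) k<n))
      (λ a b b≡1+a _ → arc⇒A≢0 (inj₁ b≡1+a)) i (suc i) refl

    A′-sub≢0 : ∀ i → suc i < n → A′ (suc i) i ≢ 0r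
    A′-sub≢0 i = padM-elim A (λ k i x → k ≡ suc i → k < n → x ≢ 0r)
      (λ outside k≡1+i k<n →
         contradiction outside (<⇒¬≤⊎≤ k<n (ℕ.<⇒≤ (subst (_< n) k≡1+i k<n))))
      (λ a b a≡1+b _ → arc⇒A≢0 (inj₂ (inj₁ a≡1+b))) (suc i) i refl

    Z-outside : ∀ {i j} → n ≤ i ⊎ n ≤ j → Z i j ≡ 0r
    Z-outside = padM-outside X ∘ swap

    Z-diagonal : ∀ t → t < m → Z t t ≡ 0r
    Z-diagonal t = padM-elim X (λ i j x → i ≡ j → i < m → x ≡ 0r) (λ _ _ _ → refl)
      (λ a b a≡b a<m → arc⇒X≡0 (inj₂ (inj₂ (toℕ-injective a≡b , prefix a a<m)))) t t refl

    Z-super : ∀ t → Z t (suc t) ≡ 0r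
    Z-super t = padM-elim X (λ i j x → i ≡ suc j → x ≡ 0r) (λ _ _ → refl)
      (λ a b a≡1+b → arc⇒X≡0 (inj₂ (inj₁ a≡1+b))) (suc t) t refl

    A′Z≡ZA′-at : ∀ a b p q →
      (∀ k → k ≢ p → A′ (toℕ a) k · Z k (toℕ b) ≡ 0r) →
      (∀ k → k ≢ q → Z (toℕ a) k · A′ k (toℕ b) ≡ 0r) →
      A′ (toℕ a) p · Z p (toℕ b) ≡ Z (toℕ a) q · A′ q (toℕ b)
    A′Z≡ZA′-at a b p q left right = begin
      A′ (toℕ a) p · Z p (toℕ b)
        ≡⟨ sym (∑-·-supported (A a) (X b) p (pad-row A a) (pad-row X b) left) ⟩
      ∑ R (λ k → A a k · X b k)
        ≡⟨ AXᵀ≡XᵀA a b ⟩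
      ∑ R (λ k → X k a · A k b)
        ≡⟨ ∑-·-supported (λ k → X k a) (λ k → A k b) q (pad-col X a) (pad-col A b) right ⟩
      Z (toℕ a) q · A′ q (toℕ b) ∎

    A′Z≡ZA′ : ∀ i j p q →
      (∀ k → k ≢ p → A′ i k · Z k j ≡ 0r) → (∀ k → k ≢ q → Z i k · A′ k j ≡ 0r) →
      A′ i p · Z p j ≡ Z i q · A′ q j
    A′Z≡ZA′ i j p q with fin-or-≥ n i | fin-or-≥ n j
    ... | inj₁ (a , refl) | inj₁ (b , refl) = A′Z≡ZA′-at a b p q
    ... | inj₂ n≤i | _ = λ _ _ →
      trans (x≡0⇒x·y≡0 (padM-outside A (inj₁ n≤i))) (sym (x≡0⇒x·y≡0 (Z-outside (inj₁ n≤i))))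
    ... | _ | inj₂ n≤j = λ _ _ →
      trans (y≡0⇒x·y≡0 (Z-outside (inj₂ n≤j))) (sym (y≡0⇒x·y≡0 (padM-outside A (inj₂ n≤j))))

  doublePath-requiresNSSP : ∀ n (L : Subset n) m → PrefixIn m L → n ≤ 2 * m →
                            RequiresNSSP R (DoublePath n L)
  doublePath-requiresNSSP n L m prefix n≤2m A A∈𝓜 X A∘X≡O AXᵀ≡XᵀA a b =
    trans (sym (padM-toℕ X a b)) (Z≡0 (toℕ b) (toℕ a))
    where
    open DoublePathPadding n L m prefix A X A∈𝓜 A∘X≡O AXᵀ≡XᵀA
    open BandedCommutation n m A′ Z A′-above A′-below A′-super≢0 A′-sub≢0
                           Z-outside Z-diagonal Z-super n≤2m A′Z≡ZA′

theorem5p3 : (R : Reals) (n : ℕ) → .{{NonZero n}} → (L : Subset n) (m : ℕ) →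
    IsLargestPrefix n L m → n ∸ 1 < 2 * m → RequiresNSSP R (DoublePath n L)
theorem5p3 R n L m (_ , prefix , _) n-1<2m =
  doublePath-requiresNSSP R n L m prefix (subst (_≤ 2 * m) (ℕ.suc-pred n) n-1<2m)
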